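{- In the non-preemptive sUETS problem, the following online algorithm is $O(\sqrt{n/m})$-competitive (i.e., there is an absolute constant $C$ such that its makespan is at most $C\sqrt{n/m}$ times the optimal makespan on every instance): let $k=m+\lceil\sqrt{mn}\rceil$; compute a partition $(X_1,\dots,X_k)$ of $J$ into $k$ (possibly empty) parts such that $|X_i|\le\lceil\sqrt{n/m}\rceil$ for all $i\in[k]$ and which, among all such partitions, minimizes $\max_{i\in[k]}c(X_i)$; then for $i=1,2,\dots,k$ in order, wait until at least one machine is available and assign batch $X_i$ to an available machine.
   Context: Non-preemptive sUETS: a finite set $J$ of $n$ jobs and $m$ identical machines, $n\ge m\ge 2$, all jobs available at time $0$. A known setup-time function $c:2^J\to\mathbb{R}_{\ge0}$ is monotone ($c(X)\le c(Y)$ for $X\subseteq Y$) and subadditive ($c(X)+c(Y)\ge c(X\cup Y)$ for disjoint $X,Y$). Each job $j$ has execution time $p_j\ge0$, unknown to an online algorithm until $j$ completes; $p(X)=\sum_{j\in X}p_j$. An algorithm repeatedly forms batches (sets of jobs not completed and not assigned elsewhere) and assigns each batch to a single idle machine, which processes batch $X$ without interruption in time $c(X)+p(X)$. The makespan is the completion time of all jobs. The optimal makespan is $\min_{(X_1,\dots,X_m)\text{ partition of }J}\max_{i}(c(X_i)+p(X_i))$. An algorithm is $\rho$-competitive if its makespan is at most $\rho$ times the optimal makespan on every instance.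
   Formalization: The setup times $c(X)$ and execution times $p_j$ are nonnegative rationals rather than elements of $\mathbb{R}_{\ge0}$. -}

module Defs where

open import Data.Bool using (Bool; true; false; if_then_else_)
open import Data.Nat as ℕ using (ℕ; zero; suc; _≤ᵇ_)
open import Data.Fin as Fin using (Fin)
open import Data.Fin.Subset using (Subset; _∈_; _⊆_; _∪_; ∣_∣)
open import Data.Vec using (Vec; []; _∷_; tabulate)
open import Data.List using (List; []; _∷_; foldl; replicate; allFin)
open import Data.Rational as ℚ using (ℚ; 0ℚ; _+_; _⊔_; _⊓_)
open import Data.Empty using (⊥)
open import Relation.Nullary.Decidable using (⌊_⌋)

Disjoint : ∀ {n} → Subset n → Subset n → Set
Disjoint X Y = ∀ j → j ∈ X → j ∈ Y → ⊥

record SetupFunction (n : ℕ) (c : Subset n → ℚ) : Set where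
  field
    nonneg      : ∀ X → 0ℚ ℚ.≤ c X
    monotone    : ∀ X Y → X ⊆ Y → c X ℚ.≤ c Y
    subadditive : ∀ X Y → Disjoint X Y → c (X ∪ Y) ℚ.≤ c X + c Y

psum : ∀ {n} → (Fin n → ℚ) → Subset n → ℚ
psum {zero}  p []       = 0ℚ
psum {suc n} p (b ∷ X) = (if b then p Fin.zero else 0ℚ) + psum (λ j → p (Fin.suc j)) X

batchTime : ∀ {n} → (Subset n → ℚ) → (Fin n → ℚ) → Subset n → ℚ
batchTime c p X = c X + psum p X

-- An (ordered) partition of J into k possibly empty parts is given by a
-- map f : Fin n → Fin k; its i-th part is X_i = f⁻¹(i).
part : ∀ {n k} → (Fin n → Fin k) → Fin k → Subset n
part f i = tabulate (λ j → ⌊ f j Fin.≟ i ⌋)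

-- maximum over Fin k of nonnegative values (0 for k = 0)
maxFin : ∀ {k} → (Fin k → ℚ) → ℚ
maxFin {zero}  g = 0ℚ
maxFin {suc k} g = g Fin.zero ⊔ maxFin (λ i → g (Fin.suc i))

maxSetup : ∀ {n k} → (Subset n → ℚ) → (Fin n → Fin k) → ℚ
maxSetup c f = maxFin (λ i → c (part f i))

-- makespan of a partition into m machine loads: max_i (c(X_i) + p(X_i))
scheduleCost : ∀ {n m} → (Subset n → ℚ) → (Fin n → ℚ) → (Fin n → Fin m) → ℚ
scheduleCost c p g = maxFin (λ i → batchTime c p (part g i))

findFrom : ℕ → ℕ → (ℕ → Bool) → ℕ
findFrom zero     t P = t
findFrom (suc f) t P = if P t then t else findFrom f (suc t) P

-- ⌈√(n/m)⌉ = least t with n ≤ m·t² (for m ≥ 1 this t is ≤ n)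
ceilSqrtFrac : ℕ → ℕ → ℕ
ceilSqrtFrac n m = findFrom n 0 (λ t → n ≤ᵇ m ℕ.* t ℕ.* t)

ceilSqrt : ℕ → ℕ
ceilSqrt N = ceilSqrtFrac N 1

-- Greedy list scheduling: machine states are their finishing times;
-- each batch (in order) goes to an earliest-available machine, i.e. a
-- machine with minimum finishing time (the first such one).

min1 : ℚ → List ℚ → ℚ
min1 x []       = x
min1 x (y ∷ ys) = x ⊓ min1 y ys

addToMin : List ℚ → ℚ → List ℚ
addToMin []           d = []
addToMin (x ∷ [])     d = (x + d) ∷ []
addToMin (x ∷ y ∷ ys) d =
  if ⌊ x ℚ.≤? min1 y ys ⌋ then (x + d) ∷ y ∷ ys else x ∷ addToMin (y ∷ ys) d

maxList : List ℚ → ℚ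
maxList = foldl _⊔_ 0ℚ

listScheduleMakespan : (m k : ℕ) → (Fin k → ℚ) → ℚ
listScheduleMakespan m k d =
  maxList (foldl (λ loads i → addToMin loads (d i)) (replicate m 0ℚ) (allFin k))

numBatches : ℕ → ℕ → ℕ
numBatches n m = m ℕ.+ ceilSqrt (m ℕ.* n)

Feasible : (n m : ℕ) → (Fin n → Fin (numBatches n m)) → Set
Feasible n m f = ∀ i → ∣ part f i ∣ ℕ.≤ ceilSqrtFrac n m

OptimalBatching : (n m : ℕ) → (Subset n → ℚ) → (Fin n → Fin (numBatches n m)) → Set
OptimalBatching n m c f =
  Feasible n m f × (∀ f' → Feasible n m f' → maxSetup c f ℚ.≤ maxSetup c f')
  where open import Data.Product using (_×_)

algMakespan : (n m : ℕ) → (Subset n → ℚ) → (Fin n → ℚ) → (Fin n → Fin (numBatches n m)) → ℚ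
algMakespan n m c p f =
  listScheduleMakespan m (numBatches n m) (λ i → batchTime c p (part f i))

ofℕ : ℕ → ℚ
ofℕ k = (Data.Integer.+ k) ℚ./ 1
  where import Data.Integer

-- Fix any m-machine schedule g of cost O. Cutting every machine set of g into chunks of at most
-- t = ⌈√(n/m)⌉ jobs gives a feasible batching into at most m + ⌈√(mn)⌉ = k parts, each contained
-- in a machine set of g, so by monotonicity of c all its setup times are at most O; hence so are
-- those of the optimal batching f. Every batch of f then takes at most O + t·O, all batches
-- together at most k·O + m·O, and Graham's list-scheduling bound m·ALG ≤ Σ d + m·max d gives
-- m·ALG ≤ (k + m + m(1 + t))·O ≤ 7·√(mn)·O.
{-# OPTIONS --safe #-}
module Submission where

open import Defs

module RationalArithmetic where

  open import Data.Bool using (true; false; if_then_else_)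
  open import Data.Fin as Fin using (Fin)
  open import Data.Fin.Subset using (_∈_; ∣_∣)
  import Data.Integer as ℤ
  import Data.Integer.Properties as ℤ
  open import Data.Nat as ℕ using (ℕ; zero; suc)
  import Data.Nat.Coprimality as Coprimality
  open import Data.Rational as ℚ using (ℚ; 0ℚ; 1ℚ; mkℚ; _+_; _*_; _≤_; toℚᵘ)
  import Data.Rational.Properties as ℚ
  open import Algebra.Properties.CommutativeMonoid.Sum ℚ.+-0-commutativeMonoid
    using (sum; ∑-distrib-+; sum-replicate-zero; sum-cong-≗)
  open import Data.Rational.Solver using (module +-*-Solver)
  import Data.Rational.Unnormalised as ℚᵘ
  import Data.Rational.Unnormalised.Properties as ℚᵘ
  open import Data.Vec using ([]; _∷_; here; there)
  open import Relation.Binary.PropositionalEquality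
  open import Relation.Nullary.Decidable using (⌊_⌋; ⌊⌋-map′)
  open +-*-Solver using (solve; _:+_; _:*_; _:=_; con)

  ofℕ≡mkℚ : ∀ k → ofℕ k ≡ mkℚ (ℤ.+ k) 0 (Coprimality.sym (Coprimality.1-coprimeTo k))
  ofℕ≡mkℚ k = ℚ.normalize-coprime _

  ofℕ-suc : ∀ k → ofℕ (suc k) ≡ 1ℚ + ofℕ k
  ofℕ-suc k = ℚ.toℚᵘ-injective (begin-equality
    toℚᵘ (ofℕ (suc k))
      ≡⟨ cong toℚᵘ (ofℕ≡mkℚ (suc k)) ⟩
    ℚᵘ.mkℚᵘ (ℤ.+ suc k) 0
      ≃⟨ ℚᵘ.*≡* (cong (λ z → (ℤ.1ℤ ℤ.+ z) ℤ.* ℤ.1ℤ) (sym (ℤ.*-identityʳ (ℤ.+ k)))) ⟩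
    ℚᵘ.1ℚᵘ ℚᵘ.+ ℚᵘ.mkℚᵘ (ℤ.+ k) 0
      ≡⟨ cong (λ x → ℚᵘ.1ℚᵘ ℚᵘ.+ toℚᵘ x) (ofℕ≡mkℚ k) ⟨
    ℚᵘ.1ℚᵘ ℚᵘ.+ toℚᵘ (ofℕ k)
      ≃⟨ ℚ.toℚᵘ-homo-+ 1ℚ (ofℕ k) ⟨
    toℚᵘ (1ℚ + ofℕ k) ∎)
    where open ℚᵘ.≤-Reasoning

  ofℕ-+ : ∀ a b → ofℕ (a ℕ.+ b) ≡ ofℕ a + ofℕ b
  ofℕ-+ zero    b = sym (ℚ.+-identityˡ (ofℕ b))
  ofℕ-+ (suc a) b = begin
    ofℕ (suc (a ℕ.+ b))    ≡⟨ ofℕ-suc (a ℕ.+ b) ⟩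
    1ℚ + ofℕ (a ℕ.+ b)     ≡⟨ cong (1ℚ +_) (ofℕ-+ a b) ⟩
    1ℚ + (ofℕ a + ofℕ b)   ≡⟨ ℚ.+-assoc 1ℚ (ofℕ a) (ofℕ b) ⟨
    1ℚ + ofℕ a + ofℕ b     ≡⟨ cong (_+ ofℕ b) (ofℕ-suc a) ⟨
    ofℕ (suc a) + ofℕ b    ∎
    where open ≡-Reasoning

  ofℕ-* : ∀ a b → ofℕ (a ℕ.* b) ≡ ofℕ a * ofℕ b
  ofℕ-* zero    b = sym (ℚ.*-zeroˡ (ofℕ b))
  ofℕ-* (suc a) b = begin
    ofℕ (b ℕ.+ a ℕ.* b)    ≡⟨ ofℕ-+ b (a ℕ.* b) ⟩
    ofℕ b + ofℕ (a ℕ.* b)  ≡⟨ cong (ofℕ b +_) (ofℕ-* a b) ⟩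
    ofℕ b + ofℕ a * ofℕ b  ≡⟨ solve 2 (λ x y → y :+ x :* y := (con 1ℚ :+ x) :* y) refl (ofℕ a) (ofℕ b) ⟩
    (1ℚ + ofℕ a) * ofℕ b   ≡⟨ cong (_* ofℕ b) (ofℕ-suc a) ⟨
    ofℕ (suc a) * ofℕ b    ∎
    where open ≡-Reasoning

  ofℕ-mono-≤ : ∀ {a b} → a ℕ.≤ b → ofℕ a ≤ ofℕ b
  ofℕ-mono-≤ {a} {b} a≤b = subst₂ _≤_ (sym (ofℕ≡mkℚ a)) (sym (ofℕ≡mkℚ b))
    (ℚ.*≤* (ℤ.*-monoʳ-≤-nonNeg ℤ.1ℤ (ℤ.+≤+ a≤b)))

  ofℕ-nonNeg : ∀ k → 0ℚ ≤ ofℕ k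
  ofℕ-nonNeg k = ofℕ-mono-≤ {0} {k} ℕ.z≤n

  ofℕ-suc-positive : ∀ k → ℚ.Positive (ofℕ (suc k))
  ofℕ-suc-positive k rewrite ofℕ≡mkℚ (suc k) = _

  p≤p+q : ∀ {p q} → 0ℚ ≤ q → p ≤ p + q
  p≤p+q {p} 0≤q = ℚ.≤-trans (ℚ.≤-reflexive (sym (ℚ.+-identityʳ p))) (ℚ.+-monoʳ-≤ p 0≤q)

  p≤q+p : ∀ {p q} → 0ℚ ≤ q → p ≤ q + p
  p≤q+p {p} {q} 0≤q = ℚ.≤-trans (p≤p+q 0≤q) (ℚ.≤-reflexive (ℚ.+-comm p q))

  +-nonNeg : ∀ {p q} → 0ℚ ≤ p → 0ℚ ≤ q → 0ℚ ≤ p + q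
  +-nonNeg = ℚ.+-mono-≤

  *-monoˡ-≤-0≤ : ∀ {r p q} → 0ℚ ≤ r → p ≤ q → r * p ≤ r * q
  *-monoˡ-≤-0≤ {r} 0≤r = ℚ.*-monoˡ-≤-nonNeg r {{ℚ.nonNegative 0≤r}}

  *-monoʳ-≤-0≤ : ∀ {r p q} → 0ℚ ≤ r → p ≤ q → p * r ≤ q * r
  *-monoʳ-≤-0≤ {r} 0≤r = ℚ.*-monoʳ-≤-nonNeg r {{ℚ.nonNegative 0≤r}}

  *-nonNeg : ∀ {p q} → 0ℚ ≤ p → 0ℚ ≤ q → 0ℚ ≤ p * q
  *-nonNeg {q = q} 0≤p 0≤q = ℚ.≤-trans (ℚ.≤-reflexive (sym (ℚ.*-zeroˡ q))) (*-monoʳ-≤-0≤ 0≤q 0≤p)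

  square-mono-≤ : ∀ {u v} → 0ℚ ≤ u → u ≤ v → u * u ≤ v * v
  square-mono-≤ 0≤u u≤v = ℚ.≤-trans (*-monoˡ-≤-0≤ 0≤u u≤v) (*-monoʳ-≤-0≤ (ℚ.≤-trans 0≤u u≤v) u≤v)

  sum-mono-≤ : ∀ {k} {f g : Fin k → ℚ} → (∀ i → f i ≤ g i) → sum f ≤ sum g
  sum-mono-≤ {zero}  f≤g = ℚ.≤-refl
  sum-mono-≤ {suc k} f≤g = ℚ.+-mono-≤ (f≤g Fin.zero) (sum-mono-≤ (λ i → f≤g (Fin.suc i)))

  sum-nonNeg : ∀ {k} {f : Fin k → ℚ} → (∀ i → 0ℚ ≤ f i) → 0ℚ ≤ sum f
  sum-nonNeg {k} {f} 0≤f = subst (_≤ sum f) (sum-replicate-zero k) (sum-mono-≤ {f = λ _ → 0ℚ} 0≤f)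

  sum-const : ∀ k x → sum {k} (λ _ → x) ≡ ofℕ k * x
  sum-const zero    x = sym (ℚ.*-zeroˡ x)
  sum-const (suc k) x = begin
    x + sum {k} (λ _ → x)  ≡⟨ cong (x +_) (sum-const k x) ⟩
    x + ofℕ k * x          ≡⟨ solve 2 (λ x y → x :+ y :* x := (con 1ℚ :+ y) :* x) refl x (ofℕ k) ⟩
    (1ℚ + ofℕ k) * x       ≡⟨ cong (_* x) (ofℕ-suc k) ⟨
    ofℕ (suc k) * x        ∎
    where open ≡-Reasoning

  sum-indicator : ∀ {k} (a : Fin k) x → sum (λ i → if ⌊ a Fin.≟ i ⌋ then x else 0ℚ) ≡ x
  sum-indicator {suc k} Fin.zero    x = trans (cong (x +_) (sum-replicate-zero k)) (ℚ.+-identityʳ x)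
  sum-indicator {suc k} (Fin.suc a) x = begin
    0ℚ + sum (λ i → if ⌊ Fin.suc a Fin.≟ Fin.suc i ⌋ then x else 0ℚ)
      ≡⟨ ℚ.+-identityˡ _ ⟩
    sum (λ i → if ⌊ Fin.suc a Fin.≟ Fin.suc i ⌋ then x else 0ℚ)
      ≡⟨ sum-cong-≗ (λ i → cong (if_then x else 0ℚ) (⌊⌋-map′ _ _ (a Fin.≟ i))) ⟩
    sum (λ i → if ⌊ a Fin.≟ i ⌋ then x else 0ℚ)
      ≡⟨ sum-indicator a x ⟩
    x ∎
    where open ≡-Reasoning

  maxFin-upper : ∀ {k} (h : Fin k → ℚ) i → h i ≤ maxFin h
  maxFin-upper h Fin.zero    = ℚ.p≤p⊔q _ _
  maxFin-upper h (Fin.suc i) =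
    ℚ.≤-trans (maxFin-upper (λ i → h (Fin.suc i)) i) (ℚ.p≤q⊔p (h Fin.zero) _)

  maxFin-least : ∀ {k} {h : Fin k → ℚ} {B} → 0ℚ ≤ B → (∀ i → h i ≤ B) → maxFin h ≤ B
  maxFin-least {zero}  0≤B h≤B = 0≤B
  maxFin-least {suc k} 0≤B h≤B =
    ℚ.⊔-lub (h≤B Fin.zero) (maxFin-least 0≤B (λ i → h≤B (Fin.suc i)))

  maxFin-nonNeg : ∀ {k} (h : Fin k → ℚ) → 0ℚ ≤ maxFin h
  maxFin-nonNeg {zero}  h = ℚ.≤-refl
  maxFin-nonNeg {suc k} h =
    ℚ.≤-trans (maxFin-nonNeg (λ i → h (Fin.suc i))) (ℚ.p≤q⊔p (h Fin.zero) _)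

  if-nonNeg : ∀ b {x} → 0ℚ ≤ x → 0ℚ ≤ (if b then x else 0ℚ)
  if-nonNeg true  0≤x = 0≤x
  if-nonNeg false 0≤x = ℚ.≤-refl

  psum-nonNeg : ∀ {n} {p : Fin n → ℚ} → (∀ j → 0ℚ ≤ p j) → ∀ X → 0ℚ ≤ psum p X
  psum-nonNeg         0≤p []      = ℚ.≤-refl
  psum-nonNeg {suc n} 0≤p (b ∷ X) =
    +-nonNeg (if-nonNeg b (0≤p Fin.zero)) (psum-nonNeg (λ j → 0≤p (Fin.suc j)) X)

  ∈⇒≤psum : ∀ {n} {p : Fin n → ℚ} → (∀ j → 0ℚ ≤ p j) → ∀ {j X} → j ∈ X → p j ≤ psum p X
  ∈⇒≤psum 0≤p {X = _ ∷ X} here        = p≤p+q (psum-nonNeg (λ j → 0≤p (Fin.suc j)) X)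
  ∈⇒≤psum 0≤p {X = b ∷ X} (there j∈X) = ℚ.≤-trans (∈⇒≤psum (λ j → 0≤p (Fin.suc j)) j∈X)
    (p≤q+p (if-nonNeg b (0≤p Fin.zero)))

  psum≤∣∣* : ∀ {n} {p : Fin n → ℚ} {B} → (∀ j → p j ≤ B) → ∀ X → psum p X ≤ ofℕ ∣ X ∣ * B
  psum≤∣∣*         {B = B} p≤B []          = ℚ.≤-reflexive (sym (ℚ.*-zeroˡ B))
  psum≤∣∣* {suc n}         p≤B (false ∷ X) =
    ℚ.≤-trans (ℚ.≤-reflexive (ℚ.+-identityˡ _)) (psum≤∣∣* (λ j → p≤B (Fin.suc j)) X)
  psum≤∣∣* {suc n} {p} {B} p≤B (true ∷ X)  = begin
    p Fin.zero + psum (λ j → p (Fin.suc j)) X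
      ≤⟨ ℚ.+-mono-≤ (p≤B Fin.zero) (psum≤∣∣* (λ j → p≤B (Fin.suc j)) X) ⟩
    B + ofℕ ∣ X ∣ * B
      ≡⟨ solve 2 (λ b x → b :+ x :* b := (con 1ℚ :+ x) :* b) refl B (ofℕ ∣ X ∣) ⟩
    (1ℚ + ofℕ ∣ X ∣) * B
      ≡⟨ cong (_* B) (ofℕ-suc ∣ X ∣) ⟨
    ofℕ (suc ∣ X ∣) * B ∎
    where open ℚ.≤-Reasoning

  sum-psum-part : ∀ {n k} (p : Fin n → ℚ) (h : Fin n → Fin k) →
    sum (λ i → psum p (part h i)) ≡ sum p
  sum-psum-part {zero}  {k} p h = sum-replicate-zero k
  sum-psum-part {suc n} {k} p h = begin
    sum (λ i → indicator i + psum p′ (part h′ i))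
      ≡⟨ ∑-distrib-+ indicator (λ i → psum p′ (part h′ i)) ⟩
    sum indicator + sum (λ i → psum p′ (part h′ i))
      ≡⟨ cong₂ _+_ (sum-indicator (h Fin.zero) (p Fin.zero)) (sum-psum-part p′ h′) ⟩
    p Fin.zero + sum p′ ∎
    where
    open ≡-Reasoning
    indicator : Fin k → ℚ
    indicator i = if ⌊ h Fin.zero Fin.≟ i ⌋ then p Fin.zero else 0ℚ
    p′ : Fin n → ℚ
    p′ j = p (Fin.suc j)
    h′ : Fin n → Fin k
    h′ j = h (Fin.suc j)

module Chunking where

  open import Data.Bool.Properties using (T-≡)
  open import Data.Fin as Fin using (Fin; toℕ; fromℕ<; combine)
  import Data.Fin.Properties as Fin
  open import Data.Fin.Subset
    using (Subset; _∈_; _∉_; _⊆_; _∪_; ∣_∣; ⁅_⁆; Empty; inside; outside)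
  open import Data.Fin.Subset.Properties
    using (p⊆q⇒∣p∣≤∣q∣; p⊂q⇒∣p∣<∣q∣; ∣⊤∣≡n; ∈⊤; ∣⊥∣≡0; ∣⁅x⁆∣≡1; x∈⁅x⁆; x∈p∪q⁺; nonempty?;
           Empty-unique)
  open import Data.Nat as ℕ using (ℕ; zero; suc; _+_; _*_; _≤_; _<_; z≤n; s≤s; NonZero; _/_; _%_)
  import Data.Nat.Properties as ℕ
  open import Data.Nat.DivMod using (m≡m%n+[m/n]*n; m%n<n; m/n*n≤m; m<n*o⇒m/o<n; /-monoˡ-≤)
  open import Data.Product using (Σ-syntax; ∃; _×_; _,_)
  open import Data.Sum using (inj₁; inj₂)
  open import Data.Vec using ([]; _∷_; tabulate)
  open import Data.Vec.Properties using (lookup∘tabulate; lookup⇒[]=; []=⇒lookup)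
  open import Function using (_∘_; Injective; Equivalence)
  open import Relation.Binary using (tri<; tri≈; tri>)
  open import Relation.Binary.PropositionalEquality
  open import Relation.Nullary using (yes; no; contradiction)
  open import Relation.Nullary.Decidable using (⌊_⌋; fromWitness; toWitness; _×-dec_)
  open import Relation.Unary using (Pred; Decidable)

  select : ∀ {n ℓ} {Q : Pred (Fin n) ℓ} → Decidable Q → Subset n
  select Q? = tabulate (λ j → ⌊ Q? j ⌋)

  module _ {n ℓ} {Q : Pred (Fin n) ℓ} (Q? : Decidable Q) {j : Fin n} where

    ∈-select⁺ : Q j → j ∈ select Q?
    ∈-select⁺ q =
      lookup⇒[]= j _ (trans (lookup∘tabulate _ j) (Equivalence.to T-≡ (fromWitness q)))

    ∈-select⁻ : j ∈ select Q? → Q j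
    ∈-select⁻ j∈ =
      toWitness (Equivalence.from T-≡ (trans (sym (lookup∘tabulate _ j)) ([]=⇒lookup j∈)))

  module _ {n k} {h : Fin n → Fin k} {x : Fin k} {j : Fin n} where

    ∈-part⁺ : h j ≡ x → j ∈ part h x
    ∈-part⁺ = ∈-select⁺ (λ j → h j Fin.≟ x)

    ∈-part⁻ : j ∈ part h x → h j ≡ x
    ∈-part⁻ = ∈-select⁻ (λ j → h j Fin.≟ x)

  ∣p∪q∣≤∣p∣+∣q∣ : ∀ {n} (p q : Subset n) → ∣ p ∪ q ∣ ≤ ∣ p ∣ + ∣ q ∣
  ∣p∪q∣≤∣p∣+∣q∣ []            []            = z≤n
  ∣p∪q∣≤∣p∣+∣q∣ (outside ∷ p) (outside ∷ q) = ∣p∪q∣≤∣p∣+∣q∣ p q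
  ∣p∪q∣≤∣p∣+∣q∣ (outside ∷ p) (inside  ∷ q) =
    ℕ.≤-trans (s≤s (∣p∪q∣≤∣p∣+∣q∣ p q)) (ℕ.≤-reflexive (sym (ℕ.+-suc ∣ p ∣ ∣ q ∣)))
  ∣p∪q∣≤∣p∣+∣q∣ (inside  ∷ p) (outside ∷ q) = s≤s (∣p∪q∣≤∣p∣+∣q∣ p q)
  ∣p∪q∣≤∣p∣+∣q∣ (inside  ∷ p) (inside  ∷ q) =
    s≤s (ℕ.≤-trans (∣p∪q∣≤∣p∣+∣q∣ p q) (ℕ.+-monoʳ-≤ ∣ p ∣ (ℕ.n≤1+n ∣ q ∣)))

  Empty⇒∣p∣≡0 : ∀ {n} {p : Subset n} → Empty p → ∣ p ∣ ≡ 0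
  Empty⇒∣p∣≡0 {n} empty = trans (cong ∣_∣ (Empty-unique empty)) (∣⊥∣≡0 n)

  ∣p∣≤1 : ∀ {n} {p : Subset n} → (∀ {i j} → i ∈ p → j ∈ p → i ≡ j) → ∣ p ∣ ≤ 1
  ∣p∣≤1 {p = p} unique with nonempty? p
  ... | yes (j , j∈p) = ℕ.≤-trans (p⊆q⇒∣p∣≤∣q∣ p⊆⁅j⁆) (ℕ.≤-reflexive (∣⁅x⁆∣≡1 j))
    where
    p⊆⁅j⁆ : p ⊆ ⁅ j ⁆
    p⊆⁅j⁆ i∈p = subst (_∈ ⁅ j ⁆) (unique j∈p i∈p) (x∈⁅x⁆ j)
  ... | no empty = ℕ.≤-trans (ℕ.≤-reflexive (Empty⇒∣p∣≡0 empty)) z≤n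

  m<[m/n]*n+n : ∀ m n .{{_ : NonZero n}} → m < m / n * n + n
  m<[m/n]*n+n m n = begin-strict
    m                  ≡⟨ m≡m%n+[m/n]*n m n ⟩
    m % n + m / n * n  <⟨ ℕ.+-monoˡ-< (m / n * n) (m%n<n m n) ⟩
    n + m / n * n      ≡⟨ ℕ.+-comm n (m / n * n) ⟩
    m / n * n + n      ∎
    where open ℕ.≤-Reasoning

  window : ∀ {n} → (Fin n → ℕ) → ℕ → ℕ → Subset n
  window r lo t = select (λ j → lo ℕ.≤? r j ×-dec r j ℕ.<? lo + t)

  module _ {n} {r : Fin n → ℕ} {lo t : ℕ} {j : Fin n} where

    ∈-window⁺ : lo ≤ r j → r j < lo + t → j ∈ window r lo t
    ∈-window⁺ lo≤rj rj<lo+t = ∈-select⁺ (λ j → lo ℕ.≤? r j ×-dec r j ℕ.<? lo + t) (lo≤rj , rj<lo+t)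

    ∈-window⁻ : j ∈ window r lo t → lo ≤ r j × r j < lo + t
    ∈-window⁻ = ∈-select⁻ (λ j → lo ℕ.≤? r j ×-dec r j ℕ.<? lo + t)

  module _ {n} {r : Fin n → ℕ} (r-injective : Injective _≡_ _≡_ r) where

    ∣window∣≤length : ∀ lo t → ∣ window r lo t ∣ ≤ t
    ∣window∣≤length lo zero    = ℕ.≤-reflexive (Empty⇒∣p∣≡0 empty)
      where
      empty : Empty (window r lo 0)
      empty (j , j∈) with lo≤rj , rj<lo+0 ← ∈-window⁻ j∈ =
        contradiction (ℕ.<-≤-trans rj<lo+0 (ℕ.≤-reflexive (ℕ.+-identityʳ lo))) (ℕ.≤⇒≯ lo≤rj)
    ∣window∣≤length lo (suc t) = begin
      ∣ window r lo (suc t) ∣        ≤⟨ p⊆q⇒∣p∣≤∣q∣ split ⟩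
      ∣ window r lo t ∪ fiber ∣      ≤⟨ ∣p∪q∣≤∣p∣+∣q∣ (window r lo t) fiber ⟩
      ∣ window r lo t ∣ + ∣ fiber ∣  ≤⟨ ℕ.+-mono-≤ (∣window∣≤length lo t) (∣p∣≤1 one-valued) ⟩
      t + 1                          ≡⟨ ℕ.+-comm t 1 ⟩
      suc t                          ∎
      where
      open ℕ.≤-Reasoning
      fiber : Subset n
      fiber = select (λ j → r j ℕ.≟ lo + t)
      one-valued : ∀ {i j} → i ∈ fiber → j ∈ fiber → i ≡ j
      one-valued i∈ j∈ = r-injective (trans (∈-select⁻ _ i∈) (sym (∈-select⁻ _ j∈)))
      split : window r lo (suc t) ⊆ window r lo t ∪ fiber
      split j∈ with lo≤rj , rj<lo+1+t ← ∈-window⁻ j∈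
        with ℕ.m≤n⇒m<n∨m≡n (ℕ.≤-pred (ℕ.≤-trans rj<lo+1+t (ℕ.≤-reflexive (ℕ.+-suc lo t))))
      ... | inj₁ rj<lo+t = x∈p∪q⁺ (inj₁ (∈-window⁺ lo≤rj rj<lo+t))
      ... | inj₂ rj≡lo+t = x∈p∪q⁺ (inj₂ (∈-select⁺ _ rj≡lo+t))

    ∣∣≤-of-equal-quotients : ∀ t .{{_ : NonZero t}} {X : Subset n} →
      (∀ {i j} → i ∈ X → j ∈ X → r i / t ≡ r j / t) → ∣ X ∣ ≤ t
    ∣∣≤-of-equal-quotients t {X} same-quotient with nonempty? X
    ... | yes (j₀ , j₀∈X) = ℕ.≤-trans (p⊆q⇒∣p∣≤∣q∣ X⊆window) (∣window∣≤length (r j₀ / t * t) t)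
      where
      X⊆window : X ⊆ window r (r j₀ / t * t) t
      X⊆window {j} j∈X rewrite same-quotient j₀∈X j∈X = ∈-window⁺ (m/n*n≤m (r j) t) (m<[m/n]*n+n (r j) t)
    ... | no empty = ℕ.≤-trans (ℕ.≤-reflexive (Empty⇒∣p∣≡0 empty)) z≤n

  module Rank {n} (κ : Fin n → ℕ) where

    below : Fin n → Subset n
    below j = select (λ i → κ i ℕ.<? κ j)

    rank : Fin n → ℕ
    rank j = ∣ below j ∣

    ∉below : ∀ j → j ∉ below j
    ∉below j j∈ = ℕ.<-irrefl refl (∈-select⁻ _ j∈)

    rank-mono-< : ∀ {i j} → κ i < κ j → rank i < rank j
    rank-mono-< {i} {j} κi<κj = p⊂q⇒∣p∣<∣q∣ (below-i⊆below-j , i , ∈-select⁺ _ κi<κj , ∉below i)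
      where
      below-i⊆below-j : below i ⊆ below j
      below-i⊆below-j x∈ = ∈-select⁺ _ (ℕ.<-trans (∈-select⁻ _ x∈) κi<κj)

    rank<n : ∀ j → rank j < n
    rank<n j = subst (rank j <_) (∣⊤∣≡n n) (p⊂q⇒∣p∣<∣q∣ ((λ _ → ∈⊤) , j , ∈⊤ , ∉below j))

    rank-injective : Injective _≡_ _≡_ κ → Injective _≡_ _≡_ rank
    rank-injective κ-injective {i} {j} rank≡ with ℕ.<-cmp (κ i) (κ j)
    ... | tri< κi<κj _ _ = contradiction rank≡ (ℕ.<⇒≢ (rank-mono-< κi<κj))
    ... | tri≈ _ κi≡κj _ = κ-injective κi≡κj
    ... | tri> _ _ κi>κj = contradiction (sym rank≡) (ℕ.<⇒≢ (rank-mono-< κi>κj))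

  -- Jobs are ordered by (machine under g, index) and cut into runs of t consecutive jobs of that
  -- order; the machine number is added to the run number so that runs on different machines never
  -- share a chunk, at the cost of at most m extra chunks.
  module Refinement {n m} (g : Fin n → Fin m) (t : ℕ) .{{_ : NonZero t}} where

    key : Fin n → ℕ
    key j = toℕ (combine (g j) j)

    key-injective : Injective _≡_ _≡_ key
    key-injective {i} {j} eq = Fin.combine-injectiveʳ (g i) i (g j) j (Fin.toℕ-injective eq)

    open Rank key public

    chunk : Fin n → ℕ
    chunk j = toℕ (g j) + rank j / t

    chunk-mono-< : ∀ {i j} → g i Fin.< g j → chunk i < chunk j
    chunk-mono-< {i} {j} gi<gj =
      ℕ.+-mono-<-≤ gi<gj (/-monoˡ-≤ t (ℕ.<⇒≤ (rank-mono-< (Fin.combine-monoˡ-< i j gi<gj))))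

    chunk-determines-machine : ∀ {i j} → chunk i ≡ chunk j → g i ≡ g j
    chunk-determines-machine {i} {j} eq with Fin.<-cmp (g i) (g j)
    ... | tri< gi<gj _ _ = contradiction eq (ℕ.<⇒≢ (chunk-mono-< gi<gj))
    ... | tri≈ _ gi≡gj _ = gi≡gj
    ... | tri> _ _ gi>gj = contradiction (sym eq) (ℕ.<⇒≢ (chunk-mono-< gi>gj))

    chunk-determines-quotient : ∀ {i j} → chunk i ≡ chunk j → rank i / t ≡ rank j / t
    chunk-determines-quotient {i} {j} eq = ℕ.+-cancelˡ-≡ (toℕ (g i)) _ _
      (trans eq (cong (λ x → toℕ x + rank j / t) (sym (chunk-determines-machine eq))))

    chunk< : ∀ s → n ≤ s * t → ∀ j → chunk j < m + s
    chunk< s n≤s*t j =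
      ℕ.+-mono-<-≤ (Fin.toℕ<n (g j)) (ℕ.<⇒≤ (m<n*o⇒m/o<n (ℕ.<-≤-trans (rank<n j) n≤s*t)))

  _Refines_ : ∀ {n k m} → (Fin n → Fin k) → (Fin n → Fin m) → Set
  h Refines g = ∀ {i j} → h i ≡ h j → g i ≡ g j

  refine : ∀ {n m} (g : Fin n → Fin m) (t s : ℕ) .{{_ : NonZero t}} → n ≤ s * t →
    Σ[ h ∈ (Fin n → Fin (m + s)) ] (∀ x → ∣ part h x ∣ ≤ t) × h Refines g
  refine {n} {m} g t s n≤s*t = h , part-small , chunk-determines-machine ∘ h≡⇒chunk≡
    where
    open Refinement g t
    h : Fin n → Fin (m + s)
    h j = fromℕ< (chunk< s n≤s*t j)
    h≡⇒chunk≡ : ∀ {i j} → h i ≡ h j → chunk i ≡ chunk j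
    h≡⇒chunk≡ eq = trans (sym (Fin.toℕ-fromℕ< _)) (trans (cong toℕ eq) (Fin.toℕ-fromℕ< _))
    part-small : ∀ x → ∣ part h x ∣ ≤ t
    part-small x = ∣∣≤-of-equal-quotients (rank-injective key-injective) t {part h x} λ i∈ j∈ →
      chunk-determines-quotient (h≡⇒chunk≡ (trans (∈-part⁻ i∈) (sym (∈-part⁻ j∈))))

  -- The index i₀ only serves the empty parts of h.
  refines⇒part⊆part : ∀ {n k m} {h : Fin n → Fin k} {g : Fin n → Fin m} → h Refines g →
    Fin m → ∀ x → ∃ λ i → part h x ⊆ part g i
  refines⇒part⊆part {h = h} {g} h-refines i₀ x with nonempty? (part h x)
  ... | yes (j₀ , j₀∈) = g j₀ , λ j∈ →
    ∈-part⁺ (h-refines (trans (∈-part⁻ j∈) (sym (∈-part⁻ j₀∈))))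
  ... | no empty       = i₀ , λ j∈ → contradiction (_ , j∈) empty

module ListScheduling where

  open RationalArithmetic using (ofℕ-suc; ofℕ-nonNeg; p≤p+q; +-nonNeg; *-nonNeg; *-monoˡ-≤-0≤; sum-nonNeg)
  open import Data.Fin as Fin using (Fin)
  open import Data.List as List using (List; []; _∷_; length; foldl; foldr; replicate; allFin; tabulate)
  import Data.List.Properties as List
  open import Data.List.Relation.Unary.All as All using (All; []; _∷_)
  import Data.List.Relation.Unary.All.Properties as All
  open import Data.Nat using (ℕ; zero; suc)
  open import Data.Product using (_×_; _,_; proj₂)
  open import Data.Rational as ℚ using (ℚ; 0ℚ; 1ℚ; _+_; _*_; _≤_; _⊔_)
  import Data.Rational.Properties as ℚ
  open import Algebra.Properties.CommutativeMonoid.Sum ℚ.+-0-commutativeMonoid using (sum)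
  open import Data.Rational.Solver using (module +-*-Solver)
  open import Data.Sum using (inj₁; inj₂)
  open import Function using (id)
  open import Relation.Binary.PropositionalEquality
  open import Relation.Nullary using (yes; no)
  open import Relation.Unary using (Pred)
  open +-*-Solver using (solve; _:+_; _:*_; _:=_; con)

  sumL : List ℚ → ℚ
  sumL = foldr _+_ 0ℚ

  sumL-tabulate : ∀ {k} (d : Fin k → ℚ) → sumL (tabulate d) ≡ sum d
  sumL-tabulate {zero}  d = refl
  sumL-tabulate {suc k} d = cong (d Fin.zero +_) (sumL-tabulate (λ i → d (Fin.suc i)))

  ⊔-preserves : ∀ {ℓ} (P : Pred ℚ ℓ) {x y} → P x → P y → P (x ⊔ y)
  ⊔-preserves P {x} {y} px py with ℚ.⊔-sel x y
  ... | inj₁ x⊔y≡x = subst P (sym x⊔y≡x) px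
  ... | inj₂ x⊔y≡y = subst P (sym x⊔y≡y) py

  foldl-⊔-preserves : ∀ {ℓ} (P : Pred ℚ ℓ) {a xs} → P a → All P xs → P (foldl _⊔_ a xs)
  foldl-⊔-preserves P pa []         = pa
  foldl-⊔-preserves P pa (px ∷ pxs) = foldl-⊔-preserves P (⊔-preserves P pa px) pxs

  ≤foldl-⊔ : ∀ a xs → a ≤ foldl _⊔_ a xs
  ≤foldl-⊔ a []       = ℚ.≤-refl
  ≤foldl-⊔ a (x ∷ xs) = ℚ.≤-trans (ℚ.p≤p⊔q a x) (≤foldl-⊔ (a ⊔ x) xs)

  listScheduleMakespan-nonNeg : ∀ m k d → 0ℚ ≤ listScheduleMakespan m k d
  listScheduleMakespan-nonNeg m k d =
    ≤foldl-⊔ 0ℚ (foldl (λ loads i → addToMin loads (d i)) (replicate m 0ℚ) (allFin k))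

  min1-lower : ∀ x xs → All (min1 x xs ≤_) (x ∷ xs)
  min1-lower x []       = ℚ.≤-refl ∷ []
  min1-lower x (y ∷ ys) =
    ℚ.p⊓q≤p x (min1 y ys) ∷ All.map (ℚ.≤-trans (ℚ.p⊓q≤q x (min1 y ys))) (min1-lower y ys)

  addToMin-preserves : ∀ {ℓ} (P : Pred ℚ ℓ) x xs d →
    All P (x ∷ xs) → P (min1 x xs + d) → All P (addToMin (x ∷ xs) d)
  addToMin-preserves P x []       d _             p-new = p-new ∷ []
  addToMin-preserves P x (y ∷ ys) d (px ∷ p-rest) p-new with x ℚ.≤? min1 y ys
  ... | yes x≤min = subst (λ z → P (z + d)) (ℚ.p≤q⇒p⊓q≡p x≤min) p-new ∷ p-rest
  ... | no  x≰min = px ∷ addToMin-preserves P y ys d p-rest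
                           (subst (λ z → P (z + d)) (ℚ.p≥q⇒p⊓q≡q (ℚ.<⇒≤ (ℚ.≰⇒> x≰min))) p-new)

  sumL-addToMin : ∀ x xs d → sumL (addToMin (x ∷ xs) d) ≡ sumL (x ∷ xs) + d
  sumL-addToMin x []       d = solve 2 (λ x d → (x :+ d) :+ con 0ℚ := (x :+ con 0ℚ) :+ d) refl x d
  sumL-addToMin x (y ∷ ys) d with x ℚ.≤? min1 y ys
  ... | yes _ = solve 3 (λ x d s → (x :+ d) :+ s := (x :+ s) :+ d) refl x d (sumL (y ∷ ys))
  ... | no  _ = trans (cong (x +_) (sumL-addToMin y ys d)) (sym (ℚ.+-assoc x (sumL (y ∷ ys)) d))

  length-addToMin : ∀ x xs d → length (addToMin (x ∷ xs) d) ≡ length (x ∷ xs)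
  length-addToMin x []       d = refl
  length-addToMin x (y ∷ ys) d with x ℚ.≤? min1 y ys
  ... | yes _ = refl
  ... | no  _ = cong suc (length-addToMin y ys d)

  length*lower≤sumL : ∀ {e} xs → All (e ≤_) xs → ofℕ (length xs) * e ≤ sumL xs
  length*lower≤sumL {e} []       []           = ℚ.≤-reflexive (ℚ.*-zeroˡ e)
  length*lower≤sumL {e} (x ∷ xs) (e≤x ∷ e≤xs) = begin
    ofℕ (suc (length xs)) * e
      ≡⟨ cong (_* e) (ofℕ-suc (length xs)) ⟩
    (1ℚ + ofℕ (length xs)) * e
      ≡⟨ solve 2 (λ e l → (con 1ℚ :+ l) :* e := e :+ l :* e) refl e (ofℕ (length xs)) ⟩
    e + ofℕ (length xs) * e
      ≤⟨ ℚ.+-mono-≤ e≤x (length*lower≤sumL xs e≤xs) ⟩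
    x + sumL xs ∎
    where open ℚ.≤-Reasoning

  module Graham (m′ : ℕ) (D : ℚ) (0≤D : 0ℚ ≤ D) where

    M : ℚ
    M = ofℕ (suc m′)

    0≤M : 0ℚ ≤ M
    0≤M = ofℕ-nonNeg (suc m′)

    -- S is the total load. A batch of length at most D goes to a least loaded machine, whose load
    -- is at most the average S / M; this is what preserves the bound on every load.
    Balanced : ℚ → List ℚ → Set
    Balanced S loads = length loads ≡ suc m′ × sumL loads ≡ S × All (λ ℓ → M * ℓ ≤ S + M * D) loads

    addToMin-balanced : ∀ {S loads x} → 0ℚ ≤ x → x ≤ D →
      Balanced S loads → Balanced (S + x) (addToMin loads x)
    addToMin-balanced {loads = []} _ _ (() , _)
    addToMin-balanced {S} {y ∷ ys} {x} 0≤x x≤D (len , sum≡S , each) =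
      trans (length-addToMin y ys x) len ,
      trans (sumL-addToMin y ys x) (cong (_+ x) sum≡S) ,
      addToMin-preserves P y ys x (All.map weaken each) (weaken M*[min+x]≤S+M*D)
      where
      P : ℚ → Set
      P ℓ = M * ℓ ≤ (S + x) + M * D
      weaken : ∀ {ℓ} → M * ℓ ≤ S + M * D → P ℓ
      weaken h = ℚ.≤-trans h (ℚ.+-monoˡ-≤ (M * D) (p≤p+q {S} 0≤x))
      M*min≤S : M * min1 y ys ≤ S
      M*min≤S = subst₂ (λ l s → ofℕ l * min1 y ys ≤ s) len sum≡S
                  (length*lower≤sumL (y ∷ ys) (min1-lower y ys))
      M*[min+x]≤S+M*D : M * (min1 y ys + x) ≤ S + M * D
      M*[min+x]≤S+M*D = begin
        M * (min1 y ys + x)    ≡⟨ ℚ.*-distribˡ-+ M (min1 y ys) x ⟩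
        M * min1 y ys + M * x  ≤⟨ ℚ.+-mono-≤ M*min≤S (*-monoˡ-≤-0≤ 0≤M x≤D) ⟩
        S + M * D              ∎
        where open ℚ.≤-Reasoning

    foldl-addToMin-balanced : ∀ {S loads ds} → All (λ x → 0ℚ ≤ x × x ≤ D) ds →
      Balanced S loads → Balanced (S + sumL ds) (foldl addToMin loads ds)
    foldl-addToMin-balanced {S} {loads} [] balanced =
      subst (λ S′ → Balanced S′ loads) (sym (ℚ.+-identityʳ S)) balanced
    foldl-addToMin-balanced {S} {loads} {x ∷ xs} ((0≤x , x≤D) ∷ bounded) balanced =
      subst (λ S′ → Balanced S′ (foldl addToMin (addToMin loads x) xs)) (ℚ.+-assoc S x (sumL xs))
        (foldl-addToMin-balanced bounded (addToMin-balanced 0≤x x≤D balanced))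

    idle-balanced : Balanced 0ℚ (replicate (suc m′) 0ℚ)
    idle-balanced =
      List.length-replicate (suc m′) , sumL-zeros (suc m′) , All.replicate⁺ (suc m′) M*0≤0+M*D
      where
      sumL-zeros : ∀ r → sumL (replicate r 0ℚ) ≡ 0ℚ
      sumL-zeros zero    = refl
      sumL-zeros (suc r) = trans (ℚ.+-identityˡ _) (sumL-zeros r)
      M*0≤0+M*D : M * 0ℚ ≤ 0ℚ + M * D
      M*0≤0+M*D = subst₂ _≤_ (sym (ℚ.*-zeroʳ M)) (sym (ℚ.+-identityˡ (M * D))) (*-nonNeg 0≤M 0≤D)

    listScheduleMakespan-bound : ∀ {k} (d : Fin k → ℚ) → (∀ i → 0ℚ ≤ d i) → (∀ i → d i ≤ D) →
      M * listScheduleMakespan (suc m′) k d ≤ sum d + M * D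
    listScheduleMakespan-bound {k} d 0≤d d≤D =
      subst₂ (λ loads S → M * foldl _⊔_ 0ℚ loads ≤ S + M * D) final-loads≡ S≡sum
        (foldl-⊔-preserves (λ ℓ → M * ℓ ≤ (0ℚ + sumL ds) + M * D) M*0≤ each)
      where
      ds : List ℚ
      ds = tabulate d
      final-loads≡ : foldl addToMin (replicate (suc m′) 0ℚ) ds
                   ≡ foldl (λ loads i → addToMin loads (d i)) (replicate (suc m′) 0ℚ) (allFin k)
      final-loads≡ = trans (cong (foldl addToMin _) (sym (List.map-tabulate id d)))
                           (List.foldl-map addToMin d _ (allFin k))
      S≡sum : 0ℚ + sumL ds ≡ sum d
      S≡sum = trans (ℚ.+-identityˡ (sumL ds)) (sumL-tabulate d)
      each : All (λ ℓ → M * ℓ ≤ (0ℚ + sumL ds) + M * D) (foldl addToMin (replicate (suc m′) 0ℚ) ds)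
      each = proj₂ (proj₂ (foldl-addToMin-balanced (All.tabulate⁺ (λ i → 0≤d i , d≤D i)) idle-balanced))
      M*0≤ : M * 0ℚ ≤ (0ℚ + sumL ds) + M * D
      M*0≤ = subst (_≤ (0ℚ + sumL ds) + M * D) (sym (ℚ.*-zeroʳ M))
               (+-nonNeg (ℚ.≤-trans (sum-nonNeg 0≤d) (ℚ.≤-reflexive (sym S≡sum))) (*-nonNeg 0≤M 0≤D))

module IntegerSquareRoots where

  open import Data.Bool using (Bool; true; false; T)
  open import Data.Nat as ℕ using (ℕ; zero; suc; _+_; _*_; _≤_; _<_; _≤ᵇ_; z≤n)
  import Data.Nat.Properties as ℕ
  open import Data.Nat.Solver using (module +-*-Solver)
  open import Data.Product using (Σ-syntax; _×_; _,_)
  open import Data.Sum as Sum using (_⊎_; inj₁; inj₂)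
  open import Data.Unit using (tt)
  open import Function using (id)
  open import Relation.Binary.PropositionalEquality
  open import Relation.Nullary using (contradiction)
  open +-*-Solver using (solve; _:+_; _:*_; _:=_; con)

  findFrom-found-or-exhausted : ∀ fuel t P → T (P (findFrom fuel t P)) ⊎ findFrom fuel t P ≡ t + fuel
  findFrom-found-or-exhausted zero       t P = inj₂ (sym (ℕ.+-identityʳ t))
  findFrom-found-or-exhausted (suc fuel) t P with P t in Pt≡
  ... | true  = inj₁ (subst T (sym Pt≡) tt)
  ... | false = Sum.map id (λ eq → trans eq (sym (ℕ.+-suc t fuel)))
                         (findFrom-found-or-exhausted fuel (suc t) P)

  findFrom-minimal : ∀ fuel t P {u} → t ≤ u → u < findFrom fuel t P → P u ≡ false
  findFrom-minimal zero       t P t≤u u<t = contradiction u<t (ℕ.≤⇒≯ t≤u)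
  findFrom-minimal (suc fuel) t P t≤u u<found with P t in Pt≡
  ... | true  = contradiction u<found (ℕ.≤⇒≯ t≤u)
  ... | false with ℕ.m≤n⇒m<n∨m≡n t≤u
  ...   | inj₁ t<u  = findFrom-minimal fuel (suc t) P t<u u<found
  ...   | inj₂ refl = Pt≡

  module _ {N a : ℕ} where

    private
      P : ℕ → Bool
      P x = N ≤ᵇ a * x * x

    ceilSqrtFrac-upper : 1 ≤ a → N ≤ a * ceilSqrtFrac N a * ceilSqrtFrac N a
    ceilSqrtFrac-upper 1≤a with findFrom-found-or-exhausted N 0 P
    ... | inj₁ found                        = ℕ.≤ᵇ⇒≤ N _ found
    ... | inj₂ exhausted rewrite exhausted = n≤a*n*n N
      where
      n≤a*n*n : ∀ n → n ≤ a * n * n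
      n≤a*n*n zero    = z≤n
      n≤a*n*n (suc n) = ℕ.≤-trans (ℕ.m≤m*n (suc n) (suc n))
                                  (ℕ.*-monoˡ-≤ (suc n) (ℕ.m≤n*m (suc n) a {{ℕ.>-nonZero 1≤a}}))

    ceilSqrtFrac-lower : 1 ≤ N → 1 ≤ a → Σ[ r ∈ ℕ ] ceilSqrtFrac N a ≡ suc r × a * r * r < N
    ceilSqrtFrac-lower 1≤N 1≤a = characterise (ceilSqrtFrac N a) refl
      where
      characterise : ∀ R → ceilSqrtFrac N a ≡ R → Σ[ r ∈ ℕ ] R ≡ suc r × a * r * r < N
      characterise zero    eq = contradiction (subst (λ R → N ≤ a * R * R) eq (ceilSqrtFrac-upper 1≤a))
                                             (ℕ.<⇒≱ (subst (_< N) (sym (ℕ.*-zeroʳ (a * 0))) 1≤N))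
      characterise (suc r) eq = r , refl , ℕ.≰⇒> λ N≤a*r*r →
        subst T (findFrom-minimal N 0 P z≤n (ℕ.≤-reflexive (sym eq))) (ℕ.≤⇒≤ᵇ N≤a*r*r)

  ceilSqrt-upper : ∀ N → N ≤ ceilSqrt N * ceilSqrt N
  ceilSqrt-upper N =
    subst (N ≤_) (cong (_* ceilSqrt N) (ℕ.*-identityˡ (ceilSqrt N))) (ceilSqrtFrac-upper ℕ.≤-refl)

  ceilSqrt-lower : ∀ N → 1 ≤ N → Σ[ r ∈ ℕ ] ceilSqrt N ≡ suc r × r * r < N
  ceilSqrt-lower N 1≤N with r , eq , lower ← ceilSqrtFrac-lower 1≤N ℕ.≤-refl
    rewrite ℕ.*-identityˡ r = r , eq , lower

  square-cancel-≤ : ∀ {u v} → u * u ≤ v * v → u ≤ v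
  square-cancel-≤ u²≤v² = ℕ.≮⇒≥ λ v<u → ℕ.<⇒≱ (ℕ.*-mono-< v<u v<u) u²≤v²

  ≤-of-squares-product : ∀ {n m s t} → 1 ≤ m → m * n ≤ s * s → n ≤ m * t * t → n ≤ s * t
  ≤-of-squares-product {n} {m} {s} {t} 1≤m mn≤s² n≤mt² =
    square-cancel-≤ (ℕ.*-cancelˡ-≤ m {{ℕ.>-nonZero 1≤m}} (begin
      m * (n * n)              ≡⟨ ℕ.*-assoc m n n ⟨
      m * n * n                ≤⟨ ℕ.*-mono-≤ mn≤s² n≤mt² ⟩
      s * s * (m * t * t)      ≡⟨ solve 3 (λ m s t → s :* s :* (m :* t :* t) := m :* ((s :* t) :* (s :* t)))
                                          refl m s t ⟩
      m * ((s * t) * (s * t))  ∎))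
    where open ℕ.≤-Reasoning

  -- a ≲ x √ B encodes a ≤ x·√B without square roots.
  infix 4 _≲_√_
  record _≲_√_ (a x B : ℕ) : Set where
    constructor square≤
    field
      square-≤ : a * a ≤ x * x * B

  ≲-+ : ∀ {a b x y B} → a ≲ x √ B → b ≲ y √ B → a + b ≲ (x + y) √ B
  ≲-+ {a} {b} {x} {y} {B} (square≤ a²≤) (square≤ b²≤) = square≤ (begin
    (a + b) * (a + b)
      ≡⟨ solve 2 (λ a b → (a :+ b) :* (a :+ b) := a :* a :+ con 2 :* (a :* b) :+ b :* b) refl a b ⟩
    a * a + 2 * (a * b) + b * b
      ≤⟨ ℕ.+-mono-≤ (ℕ.+-mono-≤ a²≤ (ℕ.*-monoʳ-≤ 2 ab≤xyB)) b²≤ ⟩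
    x * x * B + 2 * (x * y * B) + y * y * B
      ≡⟨ solve 3 (λ x y B → x :* x :* B :+ con 2 :* (x :* y :* B) :+ y :* y :* B := (x :+ y) :* (x :+ y) :* B)
                 refl x y B ⟩
    (x + y) * (x + y) * B ∎)
    where
    open ℕ.≤-Reasoning
    ab≤xyB : a * b ≤ x * y * B
    ab≤xyB = square-cancel-≤ (begin
      (a * b) * (a * b)
        ≡⟨ solve 2 (λ a b → (a :* b) :* (a :* b) := (a :* a) :* (b :* b)) refl a b ⟩
      (a * a) * (b * b)
        ≤⟨ ℕ.*-mono-≤ a²≤ b²≤ ⟩
      (x * x * B) * (y * y * B)
        ≡⟨ solve 3 (λ x y B → (x :* x :* B) :* (y :* y :* B) := (x :* y :* B) :* (x :* y :* B)) refl x y B ⟩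
      (x * y * B) * (x * y * B) ∎)

  ≲-mono : ∀ {a b x B} → a ≤ b → b ≲ x √ B → a ≲ x √ B
  ≲-mono a≤b (square≤ b²≤) = square≤ (ℕ.≤-trans (ℕ.*-mono-≤ a≤b a≤b) b²≤)

  ≲1√ : ∀ {a B} → a * a ≤ B → a ≲ 1 √ B
  ≲1√ {B = B} a²≤B = square≤ (ℕ.≤-trans a²≤B (ℕ.≤-reflexive (sym (ℕ.+-identityʳ B))))

  makespanFactor : ℕ → ℕ → ℕ
  makespanFactor n m = numBatches n m + m + m * suc (ceilSqrtFrac n m)

  makespanFactor≲7√mn : ∀ {n m} → 1 ≤ m → m ≤ n → makespanFactor n m ≲ 7 √ (m * n)
  makespanFactor≲7√mn {n} {m} 1≤m m≤n
    with s′ , s≡ , s′²<mn ← ceilSqrt-lower (m * n) (ℕ.*-mono-≤ 1≤m (ℕ.≤-trans 1≤m m≤n))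
       | t′ , t≡ , mt′²<n ← ceilSqrtFrac-lower (ℕ.≤-trans 1≤m m≤n) 1≤m
    rewrite s≡ | t≡ =
      ≲-mono factor≤ (≲-+ (≲-+ (≲-+ (≲-+ (≲-+ (≲-+ m≲ m≲) m≲) m≲) m≲) s′≲) mt′≲)
    where
    open ℕ.≤-Reasoning
    m≲ : m ≲ 1 √ (m * n)
    m≲ = ≲1√ (ℕ.*-monoʳ-≤ m m≤n)
    s′≲ : s′ ≲ 1 √ (m * n)
    s′≲ = ≲1√ (ℕ.<⇒≤ s′²<mn)
    mt′≲ : m * t′ ≲ 1 √ (m * n)
    mt′≲ = ≲1√ (begin
      (m * t′) * (m * t′)  ≡⟨ solve 2 (λ m t → (m :* t) :* (m :* t) := m :* (m :* t :* t)) refl m t′ ⟩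
      m * (m * t′ * t′)    ≤⟨ ℕ.*-monoʳ-≤ m (ℕ.<⇒≤ mt′²<n) ⟩
      m * n                ∎)
    factor≤ : m + suc s′ + m + m * suc (suc t′) ≤ m + m + m + m + m + s′ + m * t′
    factor≤ = begin
      m + suc s′ + m + m * suc (suc t′)
        ≡⟨ solve 3 (λ m s t → m :+ (con 1 :+ s) :+ m :+ m :* (con 1 :+ (con 1 :+ t))
                              := m :+ m :+ m :+ m :+ con 1 :+ s :+ m :* t) refl m s′ t′ ⟩
      m + m + m + m + 1 + s′ + m * t′
        ≤⟨ ℕ.+-monoˡ-≤ (m * t′) (ℕ.+-monoˡ-≤ s′ (ℕ.+-monoʳ-≤ (m + m + m + m) 1≤m)) ⟩
      m + m + m + m + m + s′ + m * t′ ∎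

module Competitiveness where

  open RationalArithmetic
  open Chunking using (_Refines_; refine; refines⇒part⊆part; ∈-part⁺)
  open ListScheduling using (module Graham; listScheduleMakespan-nonNeg)
  open IntegerSquareRoots
  open import Data.Fin as Fin using (Fin)
  open import Data.Fin.Subset using (Subset; ∣_∣)
  open import Data.Nat as ℕ using (ℕ; suc; NonZero)
  import Data.Nat.Properties as ℕ
  open import Data.Product using (_,_)
  open import Data.Rational as ℚ using (ℚ; 0ℚ; 1ℚ; _+_; _*_; _≤_)
  import Data.Rational.Properties as ℚ
  open import Algebra.Properties.CommutativeMonoid.Sum ℚ.+-0-commutativeMonoid using (sum; ∑-distrib-+)
  open import Data.Rational.Solver using (module +-*-Solver)
  open import Relation.Binary.PropositionalEquality
  open +-*-Solver using (solve; _:+_; _:*_; _:=_; con)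

  scheduleCost-nonNeg : ∀ {n m} (c : Subset n → ℚ) p (g : Fin n → Fin m) → 0ℚ ≤ scheduleCost c p g
  scheduleCost-nonNeg c p g = maxFin-nonNeg (λ i → batchTime c p (part g i))

  algMakespan-nonNeg : ∀ n m c p f → 0ℚ ≤ algMakespan n m c p f
  algMakespan-nonNeg n m c p f =
    listScheduleMakespan-nonNeg m (numBatches n m) (λ i → batchTime c p (part f i))

  module _ {n m} {c : Subset n → ℚ} (c-setup : SetupFunction n c)
           {p : Fin n → ℚ} (0≤p : ∀ j → 0ℚ ≤ p j) (g : Fin n → Fin m) where

    open SetupFunction c-setup

    private
      O : ℚ
      O = scheduleCost c p g

      0≤O : 0ℚ ≤ O
      0≤O = scheduleCost-nonNeg c p g

      batchTime≤O : ∀ i → batchTime c p (part g i) ≤ O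
      batchTime≤O = maxFin-upper (λ i → batchTime c p (part g i))

    setup≤scheduleCost : ∀ i → c (part g i) ≤ O
    setup≤scheduleCost i = ℚ.≤-trans (p≤p+q (psum-nonNeg 0≤p (part g i))) (batchTime≤O i)

    psum≤scheduleCost : ∀ i → psum p (part g i) ≤ O
    psum≤scheduleCost i = ℚ.≤-trans (p≤q+p (nonneg (part g i))) (batchTime≤O i)

    job≤scheduleCost : ∀ j → p j ≤ O
    job≤scheduleCost j = ℚ.≤-trans (∈⇒≤psum 0≤p (∈-part⁺ refl)) (psum≤scheduleCost (g j))

    refinement-maxSetup≤scheduleCost : ∀ {k} {h : Fin n → Fin k} → h Refines g → Fin m →
      maxSetup c h ≤ O
    refinement-maxSetup≤scheduleCost h-refines i₀ = maxFin-least 0≤O λ x →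
      let i , part⊆part = refines⇒part⊆part h-refines i₀ x
      in ℚ.≤-trans (monotone _ _ part⊆part) (setup≤scheduleCost i)

    optimalBatching-maxSetup≤scheduleCost : 1 ℕ.≤ m → m ℕ.≤ n → ∀ {f} → OptimalBatching n m c f →
      maxSetup c f ≤ O
    optimalBatching-maxSetup≤scheduleCost 1≤m m≤n (_ , f-optimal) =
      let h , h-small , h-refines = refine g t s {{t≢0}} n≤s*t
      in ℚ.≤-trans (f-optimal h h-small) (refinement-maxSetup≤scheduleCost h-refines (Fin.fromℕ< 1≤m))
      where
      t s : ℕ
      t = ceilSqrtFrac n m
      s = ceilSqrt (m ℕ.* n)
      t≢0 : NonZero t
      t≢0 with _ , t≡ , _ ← ceilSqrtFrac-lower {n} {m} (ℕ.≤-trans 1≤m m≤n) 1≤m rewrite t≡ = _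
      n≤s*t : n ℕ.≤ s ℕ.* t
      n≤s*t = ≤-of-squares-product {s = s} {t = t} 1≤m (ceilSqrt-upper (m ℕ.* n)) (ceilSqrtFrac-upper 1≤m)

    module _ {k} (f : Fin n → Fin k) (maxSetup≤O : maxSetup c f ≤ O) where

      batch-setup≤scheduleCost : ∀ i → c (part f i) ≤ O
      batch-setup≤scheduleCost i = ℚ.≤-trans (maxFin-upper (λ i → c (part f i)) i) maxSetup≤O

      batchTime≤[1+t]scheduleCost : ∀ t → (∀ i → ∣ part f i ∣ ℕ.≤ t) →
        ∀ i → batchTime c p (part f i) ≤ O + ofℕ t * O
      batchTime≤[1+t]scheduleCost t small i = ℚ.+-mono-≤ (batch-setup≤scheduleCost i)
        (ℚ.≤-trans (psum≤∣∣* job≤scheduleCost (part f i)) (*-monoʳ-≤-0≤ 0≤O (ofℕ-mono-≤ (small i))))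

      sum-batchTime≤[k+m]scheduleCost : sum (λ i → batchTime c p (part f i)) ≤ ofℕ k * O + ofℕ m * O
      sum-batchTime≤[k+m]scheduleCost = begin
        sum (λ i → batchTime c p (part f i))
          ≡⟨ ∑-distrib-+ (λ i → c (part f i)) (λ i → psum p (part f i)) ⟩
        sum (λ i → c (part f i)) + sum (λ i → psum p (part f i))
          ≡⟨ cong (sum (λ i → c (part f i)) +_) (trans (sum-psum-part p f) (sym (sum-psum-part p g))) ⟩
        sum (λ i → c (part f i)) + sum (λ i → psum p (part g i))
          ≤⟨ ℚ.+-mono-≤ (sum-mono-≤ batch-setup≤scheduleCost) (sum-mono-≤ psum≤scheduleCost) ⟩
        sum {k} (λ _ → O) + sum {m} (λ _ → O)
          ≡⟨ cong₂ _+_ (sum-const k O) (sum-const m O) ⟩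
        ofℕ k * O + ofℕ m * O ∎
        where open ℚ.≤-Reasoning

  algMakespan≤makespanFactor*scheduleCost :
    ∀ {n m′} {c : Subset n → ℚ} → SetupFunction n c → ∀ {p : Fin n → ℚ} → (∀ j → 0ℚ ≤ p j) →
    (g : Fin n → Fin (suc m′)) (f : Fin n → Fin (numBatches n (suc m′))) →
    Feasible n (suc m′) f → maxSetup c f ≤ scheduleCost c p g →
    ofℕ (suc m′) * algMakespan n (suc m′) c p f ≤ ofℕ (makespanFactor n (suc m′)) * scheduleCost c p g
  algMakespan≤makespanFactor*scheduleCost {n} {m′} {c} c-setup {p} 0≤p g f f-feasible maxSetup≤O = begin
    M * algMakespan n m c p f
      ≤⟨ Graham.listScheduleMakespan-bound m′ D 0≤D d 0≤d
           (batchTime≤[1+t]scheduleCost c-setup 0≤p g f maxSetup≤O t f-feasible) ⟩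
    sum d + M * D
      ≤⟨ ℚ.+-monoˡ-≤ (M * D) (sum-batchTime≤[k+m]scheduleCost c-setup 0≤p g f maxSetup≤O) ⟩
    ofℕ k * O + M * O + M * D
      ≡⟨ expand ⟩
    ofℕ (k ℕ.+ m ℕ.+ m ℕ.* suc t) * O ∎
    where
    open ℚ.≤-Reasoning
    m k t : ℕ
    m = suc m′
    k = numBatches n m
    t = ceilSqrtFrac n m
    M O D : ℚ
    M = ofℕ m
    O = scheduleCost c p g
    D = O + ofℕ t * O
    0≤D : 0ℚ ≤ D
    0≤D = +-nonNeg (scheduleCost-nonNeg c p g) (*-nonNeg (ofℕ-nonNeg t) (scheduleCost-nonNeg c p g))
    d : Fin k → ℚ
    d i = batchTime c p (part f i)
    0≤d : ∀ i → 0ℚ ≤ d i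
    0≤d i = +-nonNeg (SetupFunction.nonneg c-setup (part f i)) (psum-nonNeg 0≤p (part f i))
    expand : ofℕ k * O + M * O + M * D ≡ ofℕ (k ℕ.+ m ℕ.+ m ℕ.* suc t) * O
    expand = begin-equality
      ofℕ k * O + M * O + M * (O + ofℕ t * O)
        ≡⟨ solve 4 (λ K M T O → K :* O :+ M :* O :+ M :* (O :+ T :* O) := (K :+ M :+ M :* (con 1ℚ :+ T)) :* O)
                   refl (ofℕ k) M (ofℕ t) O ⟩
      (ofℕ k + M + M * (1ℚ + ofℕ t)) * O
        ≡⟨ cong (λ x → (ofℕ k + M + M * x) * O) (ofℕ-suc t) ⟨
      (ofℕ k + M + M * ofℕ (suc t)) * O
        ≡⟨ cong (_* O) (cong₂ _+_ (ofℕ-+ k m) (ofℕ-* m (suc t))) ⟨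
      (ofℕ (k ℕ.+ m) + ofℕ (m ℕ.* suc t)) * O
        ≡⟨ cong (_* O) (ofℕ-+ (k ℕ.+ m) (m ℕ.* suc t)) ⟨
      ofℕ (k ℕ.+ m ℕ.+ m ℕ.* suc t) * O ∎

  square-bound : ∀ m′ {a O : ℚ} {X C n : ℕ} → 0ℚ ≤ a → 0ℚ ≤ O →
    ofℕ (suc m′) * a ≤ ofℕ X * O → X ≲ C √ (suc m′ ℕ.* n) →
    ofℕ (suc m′) * (a * a) ≤ ofℕ (C ℕ.* C ℕ.* n) * (O * O)
  square-bound m′ {a} {O} {X} {C} {n} 0≤a 0≤O Ma≤XO (square≤ X²≤C²mn) =
    ℚ.*-cancelˡ-≤-pos M {{ofℕ-suc-positive m′}} (begin
      M * (M * (a * a))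
        ≡⟨ solve 2 (λ M a → M :* (M :* (a :* a)) := (M :* a) :* (M :* a)) refl M a ⟩
      (M * a) * (M * a)
        ≤⟨ square-mono-≤ (*-nonNeg (ofℕ-nonNeg m) 0≤a) Ma≤XO ⟩
      (ofℕ X * O) * (ofℕ X * O)
        ≡⟨ solve 2 (λ x O → (x :* O) :* (x :* O) := (x :* x) :* (O :* O)) refl (ofℕ X) O ⟩
      (ofℕ X * ofℕ X) * (O * O)
        ≡⟨ cong (_* (O * O)) (ofℕ-* X X) ⟨
      ofℕ (X ℕ.* X) * (O * O)
        ≤⟨ *-monoʳ-≤-0≤ (*-nonNeg 0≤O 0≤O) (ofℕ-mono-≤ X²≤C²mn) ⟩
      ofℕ (C ℕ.* C ℕ.* (m ℕ.* n)) * (O * O)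
        ≡⟨ cong (λ x → ofℕ x * (O * O)) C²mn≡mC²n ⟩
      ofℕ (m ℕ.* (C ℕ.* C ℕ.* n)) * (O * O)
        ≡⟨ trans (cong (_* (O * O)) (ofℕ-* m (C ℕ.* C ℕ.* n))) (ℚ.*-assoc M _ (O * O)) ⟩
      M * (ofℕ (C ℕ.* C ℕ.* n) * (O * O)) ∎)
    where
    open ℚ.≤-Reasoning
    m : ℕ
    m = suc m′
    M : ℚ
    M = ofℕ m
    C²mn≡mC²n : C ℕ.* C ℕ.* (m ℕ.* n) ≡ m ℕ.* (C ℕ.* C ℕ.* n)
    C²mn≡mC²n = trans (sym (ℕ.*-assoc (C ℕ.* C) m n))
                  (trans (cong (ℕ._* n) (ℕ.*-comm (C ℕ.* C) m)) (ℕ.*-assoc m (C ℕ.* C) n))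

open import Data.Nat using (ℕ; _≤_)
open import Data.Fin using (Fin)
open import Data.Fin.Subset using (Subset)
open import Data.Rational using (ℚ; 0ℚ; _*_)
open import Data.Product using (Σ; _×_)
import Data.Rational as Q
open import Data.Nat using (suc; s≤s; z≤n)
open import Data.Product using (_,_; proj₁)
open Competitiveness
open IntegerSquareRoots using (makespanFactor≲7√mn)

theorem4 : Σ ℕ λ C →
    (n m : ℕ) → 2 ≤ m → m ≤ n →
    (c : Subset n → ℚ) → SetupFunction n c →
    (p : Fin n → ℚ) → (∀ j → 0ℚ Q.≤ p j) →
    (f : Fin n → Fin (numBatches n m)) → OptimalBatching n m c f →
    (g : Fin n → Fin m) →
    (ofℕ m * (algMakespan n m c p f * algMakespan n m c p f))
      Q.≤ (ofℕ (C Data.Nat.* C Data.Nat.* n) * (scheduleCost c p g * scheduleCost c p g))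
theorem4 = 7 , λ where
  n (suc m′) (s≤s _) m≤n c c-setup p 0≤p f f-optimal g →
    let maxSetup≤O = optimalBatching-maxSetup≤scheduleCost c-setup 0≤p g (s≤s z≤n) m≤n f-optimal
        m*ALG≤X*O  = algMakespan≤makespanFactor*scheduleCost c-setup 0≤p g f (proj₁ f-optimal) maxSetup≤O
    in square-bound m′ (algMakespan-nonNeg n (suc m′) c p f) (scheduleCost-nonNeg c p g)
                    m*ALG≤X*O (makespanFactor≲7√mn (s≤s z≤n) m≤n)
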